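{- Let $\Gamma$ be a bipartite distance-regular graph with vertex set $X$, diameter $D\ge4$ and valency $k\ge3$, fix $x\in X$, and let $L,R$ be the lowering and raising matrices with respect to $x$. For $2\le i\le D$: (i) $E_i^*A_{i-2}E_2^*=\dfrac{1}{c_1c_2\cdots c_{i-2}}E_i^*R^{i-2}E_2^*$; (ii) $E_i^*A_iE_2^*=\dfrac{1}{c_1c_2\cdots c_i}E_i^*\Big(R^{i-1}L+R^{i-2}LR+\cdots+LR^{i-1}-\sum_{j=1}^{i-1}b_{j-1}c_jR^{i-2}\Big)E_2^*$, where the sum $R^{i-1}L+R^{i-2}LR+\cdots+LR^{i-1}$ runs over the products $R^{i-1-j}LR^{j}$, $0\le j\le i-1$.
   Context: $\Gamma$ is finite, connected, undirected, without loops or multiple edges; $\partial$ is path-length distance; $c_i=|\Gamma_{i-1}(u)\cap\Gamma_1(w)|$ and $b_i=|\Gamma_{i+1}(u)\cap\Gamma_1(w)|$ for $\partial(u,w)=i$ ($\Gamma_j(u)$ = vertices at distance $j$ from $u$); an empty product of $c$'s equals $1$. $A_i\in\mathrm{Mat}_X(\mathbb{C})$ is the $i$-th distance matrix ($(A_i)_{uw}=1$ if $\partial(u,w)=i$, else $0$), $A=A_1$. $E_i^*$ is the diagonal matrix with $(z,z)$-entry $1$ if $\partial(x,z)=i$, else $0$. $L=\sum_{h=1}^DE^*_{h-1}AE^*_h$, $R=\sum_{h=0}^{D-1}E^*_{h+1}AE^*_h$. -}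

module Defs where

open import Data.Nat as ℕ using (ℕ; zero; suc; _∸_; _≡ᵇ_)
open import Data.Bool using (Bool; true; false; if_then_else_; _∧_)
open import Data.Fin using (Fin; zero; suc)
open import Data.Integer as ℤ using (ℤ; +_)
open import Relation.Binary.PropositionalEquality using (_≡_; _≢_)
open import Data.Product using (Σ; _×_; ∃₂)
open import Function using (_∘_)

Adj : ℕ → Set
Adj n = Fin n → Fin n → Bool

IsSimpleGraph : ∀ {n} → Adj n → Set
IsSimpleGraph {n} adj =
  ((u w : Fin n) → adj u w ≡ adj w u) × ((u : Fin n) → adj u u ≡ false)

data Walk {n : ℕ} (adj : Adj n) : Fin n → Fin n → ℕ → Set where
  here : ∀ {u} → Walk adj u u 0
  step : ∀ {u v w l} → adj u v ≡ true → Walk adj v w l → Walk adj u w (suc l)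

-- ∂ is the path-length distance of the graph: ∂ u w is the length of a
-- shortest walk from u to w (existence of such a walk for all u, w also
-- encodes connectedness).
IsPathDistance : ∀ {n} → Adj n → (Fin n → Fin n → ℕ) → Set
IsPathDistance {n} adj ∂ =
  ((u w : Fin n) → Walk adj u w (∂ u w)) ×
  ((u w : Fin n) (l : ℕ) → Walk adj u w l → ∂ u w ℕ.≤ l)

count : ∀ {n} → (Fin n → Bool) → ℕ
count {zero}  f = 0
count {suc n} f = (if f zero then 1 else 0) ℕ.+ count (f ∘ suc)

IsBipartite : ∀ {n} → Adj n → Set
IsBipartite {n} adj =
  Σ (Fin n → Bool) λ col → (u w : Fin n) → adj u w ≡ true → col u ≢ col w

IsRegular : ∀ {n} → Adj n → ℕ → Set
IsRegular {n} adj k = (u : Fin n) → count (adj u) ≡ k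

HasDiameter : ∀ {n} → (Fin n → Fin n → ℕ) → ℕ → Set
HasDiameter {n} ∂ D =
  ((u w : Fin n) → ∂ u w ℕ.≤ D) × ∃₂ λ (u w : Fin n) → ∂ u w ≡ D

-- distance-regular with intersection numbers c_i (i ≥ 1) and b_i:
-- for ∂(u,w) = i, c_i = |Γ_{i-1}(u) ∩ Γ_1(w)|, b_i = |Γ_{i+1}(u) ∩ Γ_1(w)|
IsDistanceRegular : ∀ {n} → Adj n → (Fin n → Fin n → ℕ) →
                    (c b : ℕ → ℕ) → Set
IsDistanceRegular {n} adj ∂ c b =
  ((u w : Fin n) → 1 ℕ.≤ ∂ u w →
     count (λ z → (∂ u z ≡ᵇ (∂ u w ∸ 1)) ∧ adj w z) ≡ c (∂ u w)) ×
  ((u w : Fin n) →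
     count (λ z → (∂ u z ≡ᵇ suc (∂ u w)) ∧ adj w z) ≡ b (∂ u w))

Mat : ℕ → Set
Mat n = Fin n → Fin n → ℤ

sumℤ : ∀ {n} → (Fin n → ℤ) → ℤ
sumℤ {zero}  f = + 0
sumℤ {suc n} f = f zero ℤ.+ sumℤ (f ∘ suc)

infixl 7 _⊗_ _•_
infixl 6 _⊕_ _⊖_

_⊗_ : ∀ {n} → Mat n → Mat n → Mat n
(M ⊗ N) i j = sumℤ (λ k → M i k ℤ.* N k j)

_⊕_ : ∀ {n} → Mat n → Mat n → Mat n
(M ⊕ N) i j = M i j ℤ.+ N i j

_⊖_ : ∀ {n} → Mat n → Mat n → Mat n
(M ⊖ N) i j = M i j ℤ.- N i j

_•_ : ∀ {n} → ℤ → Mat n → Mat n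
(a • M) i j = a ℤ.* M i j

𝟎 : ∀ {n} → Mat n
𝟎 i j = + 0

𝟏 : ∀ {n} → Mat n
𝟏 {suc n} zero    zero    = + 1
𝟏 {suc n} (suc i) (suc j) = 𝟏 i j
𝟏 {suc n} zero    (suc j) = + 0
𝟏 {suc n} (suc i) zero    = + 0

_^ᴹ_ : ∀ {n} → Mat n → ℕ → Mat n
M ^ᴹ zero  = 𝟏
M ^ᴹ suc m = M ⊗ (M ^ᴹ m)

sumMat : ∀ {n} → ℕ → (ℕ → Mat n) → Mat n
sumMat zero    F = 𝟎
sumMat (suc m) F = sumMat m F ⊕ F m

infix 4 _≈ᴹ_
_≈ᴹ_ : ∀ {n} → Mat n → Mat n → Set
M ≈ᴹ N = ∀ i j → M i j ≡ N i j

sumℕ : ℕ → (ℕ → ℕ) → ℕ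
sumℕ zero    f = 0
sumℕ (suc m) f = sumℕ m f ℕ.+ f m

AdjMat : ∀ {n} → Adj n → Mat n
AdjMat adj u w = if adj u w then + 1 else + 0

DistMat : ∀ {n} → (Fin n → Fin n → ℕ) → ℕ → Mat n
DistMat ∂ i u w = if ∂ u w ≡ᵇ i then + 1 else + 0

Estar : ∀ {n} → (Fin n → Fin n → ℕ) → Fin n → ℕ → Mat n
Estar ∂ x i = λ u w → if ∂ x u ≡ᵇ i then 𝟏 u w else + 0

-- L = Σ_{h=1}^{D} E*_{h-1} A E*_h   (reindexed h ↦ h+1)
Lower : ∀ {n} → Adj n → (Fin n → Fin n → ℕ) → Fin n → ℕ → Mat n
Lower adj ∂ x D =
  sumMat D (λ h → Estar ∂ x h ⊗ AdjMat adj ⊗ Estar ∂ x (suc h))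

Raise : ∀ {n} → Adj n → (Fin n → Fin n → ℕ) → Fin n → ℕ → Mat n
Raise adj ∂ x D =
  sumMat D (λ h → Estar ∂ x (suc h) ⊗ AdjMat adj ⊗ Estar ∂ x h)

cprod : (ℕ → ℕ) → ℕ → ℕ
cprod c zero    = 1
cprod c (suc m) = cprod c m ℕ.* c (suc m)

module Submission where

-- Both identities are proved entrywise, since E*_a M E*_b only keeps the
-- entries of M from level a to level b (levels = distances from x).
-- After finite sums, matrix algebra and the calculus of E*, the graph theory
-- is developed in stages: path distances; bipartiteness, which forces the two
-- ends of an edge onto adjacent levels, so that A = R + L; distance-
-- regularity, which yields the three-term recurrence A A_t = c_{t+1} A_{t+1}
-- + b_{t-1} A_{t-1}.  From these, induction on t shows that R^t counts the
-- geodesics climbing t levels (R-power, giving (i)), and induction on i,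
-- peeling off the first letter of each word with one L, gives (ii)
-- (oneL-formula).

open import Defs
open import Data.Nat using (ℕ; suc; _≤_; _∸_; _*_)
open import Data.Fin using (Fin)
open import Data.Bool using (Bool)
open import Data.Integer using (+_)
open import Data.Product using (_×_)

import Data.Nat as ℕ
open import Data.Nat using (zero; _<_; _≡ᵇ_; _≟_)
import Data.Nat.Properties as ℕP
open import Data.Fin using (zero; suc) renaming (_≟_ to _≟ᶠ_)
open import Data.Bool using (true; false; if_then_else_; not; _∧_; T)
open import Data.Bool.Properties
  using (if-eta; if-cong; if-cong-then; if-swap-then; if-float; ¬-not; ∧-zeroʳ; ∧-identityʳ)
open import Data.Unit using (tt)
open import Data.Empty using (⊥-elim)
open import Relation.Nullary using (yes; no)
import Data.Integer as ℤ
open import Data.Integer using (ℤ)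
import Data.Integer.Properties as ℤP
open import Data.Integer.Tactic.RingSolver using (solve-∀)
open import Algebra.Properties.Semiring.Sum ℤP.+-*-semiring
  using (sum; sum-cong-≗; ∑-distrib-+; ∑-comm; *-distribˡ-sum; *-distribʳ-sum)
import Algebra.Properties.CommutativeSemigroup as CS
open import Data.Sum using (_⊎_; inj₁; inj₂; map₂)
open import Data.Product using (_,_; proj₁; proj₂)
open import Relation.Binary.Definitions using (tri<; tri≈; tri>)
open import Relation.Binary.PropositionalEquality
open import Function using (_∘_)

sumℤ≡sum : ∀ {n} (f : Fin n → ℤ) → sumℤ f ≡ sum f
sumℤ≡sum {zero}  f = refl
sumℤ≡sum {suc n} f = cong (λ t → f zero ℤ.+ t) (sumℤ≡sum (f ∘ suc))

sumℤ-cong : ∀ {n} {f g : Fin n → ℤ} → (∀ k → f k ≡ g k) → sumℤ f ≡ sumℤ g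
sumℤ-cong {f = f} {g} f≗g =
  trans (sumℤ≡sum f) (trans (sum-cong-≗ f≗g) (sym (sumℤ≡sum g)))

sumℤ-+ : ∀ {n} (f g : Fin n → ℤ) →
         sumℤ (λ k → f k ℤ.+ g k) ≡ sumℤ f ℤ.+ sumℤ g
sumℤ-+ f g = begin
  sumℤ (λ k → f k ℤ.+ g k) ≡⟨ sumℤ≡sum (λ k → f k ℤ.+ g k) ⟩
  sum (λ k → f k ℤ.+ g k)  ≡⟨ ∑-distrib-+ f g ⟩
  sum f ℤ.+ sum g          ≡⟨ sym (cong₂ ℤ._+_ (sumℤ≡sum f) (sumℤ≡sum g)) ⟩
  sumℤ f ℤ.+ sumℤ g        ∎
  where open ≡-Reasoning

sumℤ-*ˡ : ∀ {n} (a : ℤ) (f : Fin n → ℤ) → sumℤ (λ k → a ℤ.* f k) ≡ a ℤ.* sumℤ f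
sumℤ-*ˡ a f = begin
  sumℤ (λ k → a ℤ.* f k) ≡⟨ sumℤ≡sum (λ k → a ℤ.* f k) ⟩
  sum (λ k → a ℤ.* f k)  ≡⟨ sym (*-distribˡ-sum a f) ⟩
  a ℤ.* sum f            ≡⟨ cong (a ℤ.*_) (sym (sumℤ≡sum f)) ⟩
  a ℤ.* sumℤ f           ∎
  where open ≡-Reasoning

sumℤ-*ʳ : ∀ {n} (a : ℤ) (f : Fin n → ℤ) → sumℤ (λ k → f k ℤ.* a) ≡ sumℤ f ℤ.* a
sumℤ-*ʳ a f = begin
  sumℤ (λ k → f k ℤ.* a) ≡⟨ sumℤ≡sum (λ k → f k ℤ.* a) ⟩
  sum (λ k → f k ℤ.* a)  ≡⟨ sym (*-distribʳ-sum a f) ⟩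
  sum f ℤ.* a            ≡⟨ cong (ℤ._* a) (sym (sumℤ≡sum f)) ⟩
  sumℤ f ℤ.* a           ∎
  where open ≡-Reasoning

sumℤ-comm : ∀ {m n} (f : Fin m → Fin n → ℤ) →
            sumℤ (λ k → sumℤ (f k)) ≡ sumℤ (λ l → sumℤ (λ k → f k l))
sumℤ-comm f = begin
  sumℤ (λ k → sumℤ (f k))          ≡⟨ sumℤ-cong (λ k → sumℤ≡sum (f k)) ⟩
  sumℤ (λ k → sum (f k))           ≡⟨ sumℤ≡sum (λ k → sum (f k)) ⟩
  sum (λ k → sum (f k))            ≡⟨ ∑-comm f ⟩
  sum (λ l → sum (λ k → f k l))    ≡⟨ sym (sumℤ≡sum (λ l → sum (λ k → f k l))) ⟩
  sumℤ (λ l → sum (λ k → f k l))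
    ≡⟨ sumℤ-cong (λ l → sym (sumℤ≡sum (λ k → f k l))) ⟩
  sumℤ (λ l → sumℤ (λ k → f k l))  ∎
  where open ≡-Reasoning

𝟏-sym : ∀ {n} (u w : Fin n) → 𝟏 u w ≡ 𝟏 w u
𝟏-sym {suc n} zero    zero    = refl
𝟏-sym {suc n} zero    (suc w) = refl
𝟏-sym {suc n} (suc u) zero    = refl
𝟏-sym {suc n} (suc u) (suc w) = 𝟏-sym u w

𝟏-diag : ∀ {n} (u : Fin n) → 𝟏 u u ≡ + 1
𝟏-diag {suc n} zero    = refl
𝟏-diag {suc n} (suc u) = 𝟏-diag u

𝟏-off : ∀ {n} (u w : Fin n) → u ≢ w → 𝟏 u w ≡ + 0
𝟏-off {suc n} zero    zero    u≢w = ⊥-elim (u≢w refl)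
𝟏-off {suc n} zero    (suc w) u≢w = refl
𝟏-off {suc n} (suc u) zero    u≢w = refl
𝟏-off {suc n} (suc u) (suc w) u≢w = 𝟏-off u w (u≢w ∘ cong suc)

sum-𝟏ˡ : ∀ {n} (u : Fin n) (f : Fin n → ℤ) → sumℤ (λ k → 𝟏 u k ℤ.* f k) ≡ f u
sum-𝟏ˡ {suc n} zero f =
  trans (cong₂ ℤ._+_ (ℤP.*-identityˡ (f zero)) (sumℤ-*ˡ (+ 0) (f ∘ suc)))
        (ℤP.+-identityʳ (f zero))
sum-𝟏ˡ {suc n} (suc u) f = trans (ℤP.+-identityˡ _) (sum-𝟏ˡ u (f ∘ suc))

sum-𝟏ʳ : ∀ {n} (w : Fin n) (f : Fin n → ℤ) → sumℤ (λ k → f k ℤ.* 𝟏 k w) ≡ f w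
sum-𝟏ʳ w f = trans
  (sumℤ-cong (λ k → trans (ℤP.*-comm (f k) (𝟏 k w)) (cong (ℤ._* f k) (𝟏-sym k w))))
  (sum-𝟏ˡ w f)

𝟏-guard : ∀ {n} (p : Fin n → Bool) (l w : Fin n) →
          (if p l then 𝟏 l w else + 0) ≡ (if p w then 𝟏 l w else + 0)
𝟏-guard p l w with l ≟ᶠ w
... | yes refl = refl
... | no l≢w rewrite 𝟏-off l w l≢w = trans (if-eta (p l)) (sym (if-eta (p w)))

≡ᵇ-true : ∀ {m n} → m ≡ n → (m ≡ᵇ n) ≡ true
≡ᵇ-true {m} {n} m≡n with m ≡ᵇ n | ℕP.≡⇒≡ᵇ m n m≡n
... | true | _ = refl

≡ᵇ-false : ∀ {m n} → m ≢ n → (m ≡ᵇ n) ≡ false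
≡ᵇ-false {m} {n} m≢n with m ≡ᵇ n | ℕP.≡ᵇ⇒≡ m n
... | false | _     = refl
... | true  | sound = ⊥-elim (m≢n (sound tt))

if-yes : ∀ {a} {A : Set a} {m n : ℕ} {x y : A} → m ≡ n → (if m ≡ᵇ n then x else y) ≡ x
if-yes m≡n = if-cong (≡ᵇ-true m≡n)

if-no : ∀ {a} {A : Set a} {m n : ℕ} {x y : A} → m ≢ n → (if m ≡ᵇ n then x else y) ≡ y
if-no m≢n = if-cong (≡ᵇ-false m≢n)

if-zero : ∀ β {x : ℤ} → x ≡ + 0 → (if β then x else + 0) ≡ + 0
if-zero β x≡0 = trans (if-cong-then β x≡0) (if-eta β)

if-substitute : ∀ {a} {A : Set a} (f : ℕ → A) m n {y : A} →
                (if m ≡ᵇ n then f m else y) ≡ (if m ≡ᵇ n then f n else y)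
if-substitute f m n with m ≟ n
... | yes refl = refl
... | no m≢n   = trans (if-no m≢n) (sym (if-no m≢n))

guarded-cong : ∀ (β γ : Bool) {x y : ℤ} → (T β → T γ → x ≡ y) →
               (if β then (if γ then x else + 0) else + 0) ≡
               (if β then (if γ then y else + 0) else + 0)
guarded-cong true  true  x≡y = x≡y tt tt
guarded-cong true  false x≡y = refl
guarded-cong false γ     x≡y = refl

≈-sym : ∀ {n} {M N : Mat n} → M ≈ᴹ N → N ≈ᴹ M
≈-sym M≈N u w = sym (M≈N u w)

≈-trans : ∀ {n} {M N P : Mat n} → M ≈ᴹ N → N ≈ᴹ P → M ≈ᴹ P
≈-trans M≈N N≈P u w = trans (M≈N u w) (N≈P u w)

⊗-congʳ : ∀ {n} {M M′ : Mat n} (N : Mat n) → M ≈ᴹ M′ → M ⊗ N ≈ᴹ M′ ⊗ N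
⊗-congʳ N M≈M′ u w = sumℤ-cong (λ k → cong (ℤ._* N k w) (M≈M′ u k))

⊗-assoc : ∀ {n} (M N P : Mat n) → (M ⊗ N) ⊗ P ≈ᴹ M ⊗ (N ⊗ P)
⊗-assoc M N P u w = begin
  sumℤ (λ l → sumℤ (λ k → M u k ℤ.* N k l) ℤ.* P l w)
    ≡⟨ sumℤ-cong (λ l → sym (sumℤ-*ʳ (P l w) (λ k → M u k ℤ.* N k l))) ⟩
  sumℤ (λ l → sumℤ (λ k → M u k ℤ.* N k l ℤ.* P l w))
    ≡⟨ sumℤ-comm (λ l k → M u k ℤ.* N k l ℤ.* P l w) ⟩
  sumℤ (λ k → sumℤ (λ l → M u k ℤ.* N k l ℤ.* P l w))
    ≡⟨ sumℤ-cong (λ k → sumℤ-cong (λ l → ℤP.*-assoc (M u k) (N k l) (P l w))) ⟩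
  sumℤ (λ k → sumℤ (λ l → M u k ℤ.* (N k l ℤ.* P l w)))
    ≡⟨ sumℤ-cong (λ k → sumℤ-*ˡ (M u k) (λ l → N k l ℤ.* P l w)) ⟩
  sumℤ (λ k → M u k ℤ.* sumℤ (λ l → N k l ℤ.* P l w))
    ∎
  where open ≡-Reasoning

⊗-identityˡ : ∀ {n} (M : Mat n) → 𝟏 ⊗ M ≈ᴹ M
⊗-identityˡ M u w = sum-𝟏ˡ u (λ k → M k w)

⊗-zeroʳ : ∀ {n} (M : Mat n) → M ⊗ 𝟎 ≈ᴹ 𝟎
⊗-zeroʳ M u w = trans (sumℤ-*ʳ (+ 0) (M u)) (ℤP.*-zeroʳ (sumℤ (M u)))

⊗-distribˡ-⊕ : ∀ {n} (M N P : Mat n) → M ⊗ (N ⊕ P) ≈ᴹ M ⊗ N ⊕ M ⊗ P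
⊗-distribˡ-⊕ M N P u w =
  trans (sumℤ-cong (λ k → ℤP.*-distribˡ-+ (M u k) (N k w) (P k w)))
        (sumℤ-+ (λ k → M u k ℤ.* N k w) (λ k → M u k ℤ.* P k w))

⊗-distribʳ-⊕ : ∀ {n} (M N P : Mat n) → (M ⊕ N) ⊗ P ≈ᴹ M ⊗ P ⊕ N ⊗ P
⊗-distribʳ-⊕ M N P u w =
  trans (sumℤ-cong (λ k → ℤP.*-distribʳ-+ (P k w) (M u k) (N u k)))
        (sumℤ-+ (λ k → M u k ℤ.* P k w) (λ k → N u k ℤ.* P k w))

•-⊗ : ∀ {n} (a : ℤ) (M N : Mat n) → (a • M) ⊗ N ≈ᴹ a • (M ⊗ N)
•-⊗ a M N u w =
  trans (sumℤ-cong (λ k → ℤP.*-assoc a (M u k) (N k w)))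
        (sumℤ-*ˡ a (λ k → M u k ℤ.* N k w))

⊗-• : ∀ {n} (a : ℤ) (M N : Mat n) → M ⊗ (a • N) ≈ᴹ a • (M ⊗ N)
⊗-• a M N u w =
  trans (sumℤ-cong (λ k → CS.x∙yz≈y∙xz ℤP.*-commutativeSemigroup (M u k) a (N k w)))
        (sumℤ-*ˡ a (λ k → M u k ℤ.* N k w))

•-sandwich : ∀ {n} (a : ℤ) (P M Q : Mat n) → a • (P ⊗ M ⊗ Q) ≈ᴹ P ⊗ (a • M) ⊗ Q
•-sandwich a P M Q =
  ≈-trans (≈-sym (•-⊗ a (P ⊗ M) Q)) (⊗-congʳ Q (≈-sym (⊗-• a P M)))

support-cong : ∀ {n} (M N N′ : Mat n) (u w : Fin n) →
               (∀ z → M u z ≡ + 0 ⊎ N z w ≡ N′ z w) →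
               (M ⊗ N) u w ≡ (M ⊗ N′) u w
support-cong M N N′ u w on-support = sumℤ-cong term
  where
  term : ∀ z → M u z ℤ.* N z w ≡ M u z ℤ.* N′ z w
  term z with on-support z
  ... | inj₁ Muz≡0 = trans (cong (ℤ._* N z w) Muz≡0) (sym (cong (ℤ._* N′ z w) Muz≡0))
  ... | inj₂ N≡N′  = cong (M u z ℤ.*_) N≡N′

sumMat-cong : ∀ {n} m {F G : ℕ → Mat n} → (∀ j → j < m → F j ≈ᴹ G j) →
              sumMat m F ≈ᴹ sumMat m G
sumMat-cong zero    F≈G u w = refl
sumMat-cong (suc m) F≈G u w =
  cong₂ ℤ._+_ (sumMat-cong m (λ j j<m → F≈G j (ℕP.m<n⇒m<1+n j<m)) u w)
              (F≈G m ℕP.≤-refl u w)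

⊗-sumMat : ∀ {n} m (M : Mat n) (F : ℕ → Mat n) →
           M ⊗ sumMat m F ≈ᴹ sumMat m (λ j → M ⊗ F j)
⊗-sumMat zero    M F = ⊗-zeroʳ M
⊗-sumMat (suc m) M F u w =
  trans (⊗-distribˡ-⊕ M (sumMat m F) (F m) u w)
        (cong (ℤ._+ (M ⊗ F m) u w) (⊗-sumMat m M F u w))

sumMat-zero : ∀ {n} m (F : ℕ → Mat n) (u w : Fin n) →
              (∀ h → h < m → F h u w ≡ + 0) → sumMat m F u w ≡ + 0
sumMat-zero zero    F u w vanish = refl
sumMat-zero (suc m) F u w vanish =
  cong₂ ℤ._+_ (sumMat-zero m F u w (λ h h<m → vanish h (ℕP.m<n⇒m<1+n h<m)))
              (vanish m ℕP.≤-refl)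

sumMat-pick : ∀ {n} m (F : ℕ → Mat n) (u w : Fin n) p {X : ℤ} → p < m →
              (∀ h → F h u w ≡ (if h ≡ᵇ p then X else + 0)) → sumMat m F u w ≡ X
sumMat-pick (suc m) F u w p {X} p<1+m term with p ≟ m
... | yes refl = trans
  (cong₂ ℤ._+_ (sumMat-zero p F u w (λ h h<p → trans (term h) (if-no (ℕP.<⇒≢ h<p))))
               (trans (term p) (if-yes {m = p} refl)))
  (ℤP.+-identityˡ X)
... | no p≢m = trans
  (cong₂ ℤ._+_ (sumMat-pick m F u w p (ℕP.≤∧≢⇒< (ℕP.≤-pred p<1+m) p≢m) term)
               (trans (term m) (if-no (p≢m ∘ sym))))
  (ℤP.+-identityʳ _)

sumMat-transpose : ∀ {n} m (F G : ℕ → Mat n) → (∀ h u w → F h u w ≡ G h w u) →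
                   ∀ u w → sumMat m F u w ≡ sumMat m G w u
sumMat-transpose zero    F G F≡Gᵀ u w = refl
sumMat-transpose (suc m) F G F≡Gᵀ u w =
  cong₂ ℤ._+_ (sumMat-transpose m F G F≡Gᵀ u w) (F≡Gᵀ m u w)

oneL : ∀ {n} → Mat n → Mat n → ℕ → Mat n
oneL R L i = sumMat i (λ j → (R ^ᴹ (i ∸ 1 ∸ j)) ⊗ L ⊗ (R ^ᴹ j))

-- Such a word of length i+1 either begins with R or equals L R^i.
oneL-step : ∀ {n} (R L : Mat n) i → oneL R L (suc i) ≈ᴹ R ⊗ oneL R L i ⊕ L ⊗ (R ^ᴹ i)
oneL-step R L i u w = cong₂ ℤ._+_ (leading-R u w) (leading-L u w)
  where
  exponent : ∀ {j} → j < i → i ∸ j ≡ suc (i ∸ 1 ∸ j)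
  exponent {j} j<i = trans (ℕP.+-∸-assoc 1 j<i) (cong suc (sym (ℕP.∸-+-assoc i 1 j)))

  term : ∀ j → j < i → (R ^ᴹ (i ∸ j)) ⊗ L ⊗ (R ^ᴹ j) ≈ᴹ
                       R ⊗ ((R ^ᴹ (i ∸ 1 ∸ j)) ⊗ L ⊗ (R ^ᴹ j))
  term j j<i = ≈-trans (λ u w → cong (λ e → ((R ^ᴹ e) ⊗ L ⊗ (R ^ᴹ j)) u w) (exponent j<i))
    (≈-trans (⊗-congʳ (R ^ᴹ j) (⊗-assoc R (R ^ᴹ (i ∸ 1 ∸ j)) L))
             (⊗-assoc R ((R ^ᴹ (i ∸ 1 ∸ j)) ⊗ L) (R ^ᴹ j)))

  leading-R : sumMat i (λ j → (R ^ᴹ (i ∸ j)) ⊗ L ⊗ (R ^ᴹ j)) ≈ᴹ R ⊗ oneL R L i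
  leading-R = ≈-trans (sumMat-cong i term) (≈-sym (⊗-sumMat i R _))

  leading-L : (R ^ᴹ (i ∸ i)) ⊗ L ⊗ (R ^ᴹ i) ≈ᴹ L ⊗ (R ^ᴹ i)
  leading-L = ≈-trans (λ u w → cong (λ e → ((R ^ᴹ e) ⊗ L ⊗ (R ^ᴹ i)) u w) (ℕP.n∸n≡0 i))
                      (⊗-congʳ (R ^ᴹ i) (⊗-identityˡ L))

module DualIdempotents {n} (∂ : Fin n → Fin n → ℕ) (x : Fin n) where

  lvl : Fin n → ℕ
  lvl = ∂ x

  E : ℕ → Mat n
  E = Estar ∂ x

  E-left : ∀ a (M : Mat n) u w → (E a ⊗ M) u w ≡ (if lvl u ≡ᵇ a then M u w else + 0)
  E-left a M u w = select (lvl u ≡ᵇ a)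
    where
    select : ∀ β → sumℤ (λ l → (if β then 𝟏 u l else + 0) ℤ.* M l w) ≡
                   (if β then M u w else + 0)
    select true  = sum-𝟏ˡ u (λ l → M l w)
    select false = sumℤ-*ˡ (+ 0) (λ l → M l w)

  E-right : ∀ a (M : Mat n) u w → (M ⊗ E a) u w ≡ (if lvl w ≡ᵇ a then M u w else + 0)
  E-right a M u w =
    trans (sumℤ-cong (λ l → cong (M u l ℤ.*_) (𝟏-guard (λ v → lvl v ≡ᵇ a) l w)))
          (select (lvl w ≡ᵇ a))
    where
    select : ∀ β → sumℤ (λ l → M u l ℤ.* (if β then 𝟏 l w else + 0)) ≡
                   (if β then M u w else + 0)
    select true  = sum-𝟏ʳ w (M u)
    select false = trans (sumℤ-*ʳ (+ 0) (M u)) (ℤP.*-zeroʳ (sumℤ (M u)))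

  sandwich : ∀ a b (M : Mat n) u w → (E a ⊗ M ⊗ E b) u w ≡
             (if lvl u ≡ᵇ a then (if lvl w ≡ᵇ b then M u w else + 0) else + 0)
  sandwich a b M u w =
    trans (E-right b (E a ⊗ M) u w)
          (trans (if-cong-then (lvl w ≡ᵇ b) (E-left a M u w))
                 (if-swap-then (lvl w ≡ᵇ b) (lvl u ≡ᵇ a)))

  sandwich-cong : ∀ a b {M N : Mat n} →
                  (∀ u w → lvl u ≡ a → lvl w ≡ b → M u w ≡ N u w) →
                  E a ⊗ M ⊗ E b ≈ᴹ E a ⊗ N ⊗ E b
  sandwich-cong a b {M} {N} M≡N u w =
    trans (sandwich a b M u w)
          (trans (guarded-cong (lvl u ≡ᵇ a) (lvl w ≡ᵇ b)
                   (λ at-a at-b → M≡N u w (ℕP.≡ᵇ⇒≡ (lvl u) a at-a)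
                                          (ℕP.≡ᵇ⇒≡ (lvl w) b at-b)))
                 (sym (sandwich a b N u w)))

  sandwich-transpose : ∀ a b (M : Mat n) → (∀ u w → M u w ≡ M w u) →
                       ∀ u w → (E a ⊗ M ⊗ E b) u w ≡ (E b ⊗ M ⊗ E a) w u
  sandwich-transpose a b M M-sym u w =
    trans (sandwich a b M u w)
          (trans (if-swap-then (lvl u ≡ᵇ a) (lvl w ≡ᵇ b))
                 (trans (if-cong-then (lvl w ≡ᵇ b) (if-cong-then (lvl u ≡ᵇ a) (M-sym u w)))
                        (sym (sandwich b a M w u))))

module PathDistance {n} (adj : Adj n) (∂ : Fin n → Fin n → ℕ)
                    (simple : IsSimpleGraph adj) (pd : IsPathDistance adj ∂) where

  A : Mat n
  A = AdjMat adj

  adj-sym : ∀ {u w} → adj u w ≡ true → adj w u ≡ true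
  adj-sym {u} {w} = trans (proj₁ simple w u)

  adjacent-or-zero : ∀ u w → adj u w ≡ true ⊎ A u w ≡ + 0
  adjacent-or-zero u w with adj u w
  ... | true  = inj₁ refl
  ... | false = inj₂ refl

  A-sym : ∀ u w → A u w ≡ A w u
  A-sym u w = cong (λ β → if β then + 1 else + 0) (proj₁ simple u w)

  snoc : ∀ {u v w l} → Walk adj u v l → adj v w ≡ true → Walk adj u w (suc l)
  snoc here         e = step e here
  snoc (step e′ p) e = step e′ (snoc p e)

  reverse : ∀ {u w l} → Walk adj u w l → Walk adj w u l
  reverse here       = here
  reverse (step e p) = snoc (reverse p) (adj-sym e)

  _++ʷ_ : ∀ {u v w l m} → Walk adj u v l → Walk adj v w m → Walk adj u w (l ℕ.+ m)
  here     ++ʷ q = q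
  step e p ++ʷ q = step e (p ++ʷ q)

  geodesic : ∀ u w → Walk adj u w (∂ u w)
  geodesic = proj₁ pd

  shortest : ∀ u w l → Walk adj u w l → ∂ u w ≤ l
  shortest = proj₂ pd

  ∂-sym : ∀ u w → ∂ u w ≡ ∂ w u
  ∂-sym u w = ℕP.≤-antisym (shortest u w _ (reverse (geodesic w u)))
                           (shortest w u _ (reverse (geodesic u w)))

  ∂-triangle : ∀ u v w → ∂ u w ≤ ∂ u v ℕ.+ ∂ v w
  ∂-triangle u v w = shortest u w _ (geodesic u v ++ʷ geodesic v w)

  ∂-step : ∀ u v z → adj v z ≡ true → ∂ u z ≤ suc (∂ u v)
  ∂-step u v z e = shortest u z _ (snoc (geodesic u v) e)

  ∂-refl : ∀ u → ∂ u u ≡ 0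
  ∂-refl u = ℕP.n≤0⇒n≡0 (shortest u u 0 here)

  ∂≡0⇒≡ : ∀ u w → ∂ u w ≡ 0 → u ≡ w
  ∂≡0⇒≡ u w ∂≡0 = endpoints (subst (Walk adj u w) ∂≡0 (geodesic u w))
    where
    endpoints : Walk adj u w 0 → u ≡ w
    endpoints here = refl

  𝟏≡A₀ : ∀ u w → 𝟏 u w ≡ DistMat ∂ 0 u w
  𝟏≡A₀ u w with u ≟ᶠ w
  ... | yes refl = trans (𝟏-diag u) (sym (if-yes (∂-refl u)))
  ... | no u≢w   = trans (𝟏-off u w u≢w) (sym (if-no (u≢w ∘ ∂≡0⇒≡ u w)))

differ-by-one : ∀ {a b} → a ≤ suc b → b ≤ suc a → a ≢ b → a ≡ suc b ⊎ b ≡ suc a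
differ-by-one {a} {b} a≤1+b b≤1+a a≢b with ℕP.<-cmp a b
... | tri< a<b _ _ = inj₂ (ℕP.≤-antisym b≤1+a a<b)
... | tri≈ _ a≡b _ = ⊥-elim (a≢b a≡b)
... | tri> _ _ b<a = inj₁ (ℕP.≤-antisym a≤1+b b<a)

not-both-ways : ∀ {a b} → a ≡ suc b → b ≢ suc a
not-both-ways {a} {b} a≡1+b b≡1+a = ℕP.m≢1+n+m b {1} (trans b≡1+a (cong suc a≡1+b))

module BipartiteDistance {n} (adj : Adj n) (∂ : Fin n → Fin n → ℕ)
                         (simple : IsSimpleGraph adj) (pd : IsPathDistance adj ∂)
                         (bip : IsBipartite adj) where

  open PathDistance adj ∂ simple pd

  -- The proper 2-colouring alternates along walks, so walks between two
  -- vertices of equal colour have even length.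
  colour : Fin n → Bool
  colour = proj₁ bip

  colour-step : ∀ {u v} → adj u v ≡ true → colour v ≡ not (colour u)
  colour-step {u} {v} e = ¬-not (proj₂ bip u v e ∘ sym)

  flip : ℕ → Bool → Bool
  flip zero    β = β
  flip (suc l) β = flip l (not β)

  colour-walk : ∀ {u w l} → Walk adj u w l → colour w ≡ flip l (colour u)
  colour-walk here                   = refl
  colour-walk (step {l = l} e p) = trans (colour-walk p) (cong (flip l) (colour-step e))

  -- the two ends of an edge have different colours, hence different distances
  parity : ∀ u w z → adj w z ≡ true → ∂ u z ≢ ∂ u w
  parity u w z e same = proj₂ bip w z e
    (trans (colour-walk (geodesic u w))
           (trans (cong (λ l → flip l (colour u)) (sym same))
                  (sym (colour-walk (geodesic u z)))))

  neighbour-distances : ∀ u w z → adj w z ≡ true →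
                        ∂ u z ≡ suc (∂ u w) ⊎ ∂ u w ≡ suc (∂ u z)
  neighbour-distances u w z e =
    differ-by-one (∂-step u w z e) (∂-step u z w (adj-sym e)) (parity u w z e)

count-none : ∀ {n} (P : Fin n → Bool) → (∀ z → P z ≡ false) → count P ≡ 0
count-none {zero}  P none = refl
count-none {suc n} P none rewrite none zero = count-none (P ∘ suc) (none ∘ suc)

sum-indicator : ∀ {n} (P : Fin n → Bool) →
                sumℤ (λ z → if P z then + 1 else + 0) ≡ + count P
sum-indicator {zero}  P = refl
sum-indicator {suc n} P = begin
  (if P zero then + 1 else + 0) ℤ.+ sumℤ (λ z → if P (suc z) then + 1 else + 0)
    ≡⟨ cong₂ ℤ._+_ (sym (if-float +_ (P zero))) (sum-indicator (P ∘ suc)) ⟩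
  + (if P zero then 1 else 0) ℤ.+ + count (P ∘ suc)
    ≡⟨ sym (ℤP.pos-+ (if P zero then 1 else 0) (count (P ∘ suc))) ⟩
  + count P
    ∎
  where open ≡-Reasoning

indicator-∧ : ∀ (p q : Bool) →
  (if q then + 1 else + 0) ℤ.* (if p then + 1 else + 0) ≡ (if p ∧ q then + 1 else + 0)
indicator-∧ true  true  = refl
indicator-∧ true  false = refl
indicator-∧ false true  = refl
indicator-∧ false false = refl

guard-as-multiple : ∀ (β : Bool) m → + (if β then m else 0) ≡ + m ℤ.* (if β then + 1 else + 0)
guard-as-multiple true  m = sym (ℤP.*-identityʳ (+ m))
guard-as-multiple false m = sym (ℤP.*-zeroʳ (+ m))

module DistanceRegular {n} (adj : Adj n) (∂ : Fin n → Fin n → ℕ) (c b : ℕ → ℕ)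
                       (simple : IsSimpleGraph adj) (pd : IsPathDistance adj ∂)
                       (bip : IsBipartite adj) (dr : IsDistanceRegular adj ∂ c b) where

  open PathDistance adj ∂ simple pd
  open BipartiteDistance adj ∂ simple pd bip

  -- A neighbour z of u has ∂ w z = ∂ w u ± 1, so none is at any other distance m.
  off-distance : ∀ w u m z → ∂ w u ≢ suc m → suc (∂ w u) ≢ m →
                 ((∂ w z ≡ᵇ m) ∧ adj u z) ≡ false
  off-distance w u m z d≢1+m 1+d≢m with adj u z in e
  ... | false = ∧-zeroʳ (∂ w z ≡ᵇ m)
  ... | true  = trans (∧-identityʳ (∂ w z ≡ᵇ m)) (≡ᵇ-false away)
    where
    away : ∂ w z ≢ m
    away ∂wz≡m with neighbour-distances w u z e
    ... | inj₁ up   = 1+d≢m (trans (sym up) ∂wz≡m)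
    ... | inj₂ down = d≢1+m (trans down (cong suc ∂wz≡m))

  neighbour-count : ∀ w u m →
    count (λ z → (∂ w z ≡ᵇ m) ∧ adj u z) ≡
    (if ∂ w u ≡ᵇ suc m then c (suc m) else 0) ℕ.+ (if suc (∂ w u) ≡ᵇ m then b (∂ w u) else 0)
  neighbour-count w u m with ∂ w u ≟ suc m
  ... | yes d≡1+m =
    trans (subst (λ d → 1 ≤ d → count (λ z → (∂ w z ≡ᵇ (d ∸ 1)) ∧ adj u z) ≡ c d)
                 d≡1+m (proj₁ dr w u) (ℕ.s≤s ℕ.z≤n))
          (sym (trans (cong₂ ℕ._+_ (if-yes d≡1+m) (if-no 1+d≢m)) (ℕP.+-identityʳ (c (suc m)))))
    where
    1+d≢m : suc (∂ w u) ≢ m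
    1+d≢m = not-both-ways d≡1+m ∘ sym
  ... | no d≢1+m with suc (∂ w u) ≟ m
  ...   | yes 1+d≡m =
    trans (subst (λ t → count (λ z → (∂ w z ≡ᵇ t) ∧ adj u z) ≡ b (∂ w u))
                 1+d≡m (proj₂ dr w u))
          (sym (cong₂ ℕ._+_ (if-no d≢1+m) (if-yes 1+d≡m)))
  ...   | no 1+d≢m =
    trans (count-none _ (λ z → off-distance w u m z d≢1+m 1+d≢m))
          (sym (cong₂ ℕ._+_ (if-no d≢1+m) (if-no 1+d≢m)))

  lowerTerm : ℕ → Mat n
  lowerTerm zero    = 𝟎
  lowerTerm (suc s) = + b s • DistMat ∂ s

  lowerTerm-off : ∀ t u w → suc t ≤ ∂ u w → lowerTerm t u w ≡ + 0
  lowerTerm-off zero    u w _   = refl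
  lowerTerm-off (suc s) u w gap =
    trans (cong (+ b s ℤ.*_) (if-no (ℕP.>⇒≢ (ℕP.<⇒≤ gap)))) (ℤP.*-zeroʳ (+ b s))

  -- Entry (u,w) of A A_t counts the neighbours of u at distance t from w.
  three-term : ∀ t → A ⊗ DistMat ∂ t ≈ᴹ (+ c (suc t)) • DistMat ∂ (suc t) ⊕ lowerTerm t
  three-term t u w = begin
    (A ⊗ DistMat ∂ t) u w
      ≡⟨ sumℤ-cong (λ z → trans (indicator-∧ (∂ z w ≡ᵇ t) (adj u z))
                                (cong (λ d′ → if (d′ ≡ᵇ t) ∧ adj u z then + 1 else + 0)
                                      (∂-sym z w))) ⟩
    sumℤ (λ z → if (∂ w z ≡ᵇ t) ∧ adj u z then + 1 else + 0)
      ≡⟨ sum-indicator (λ z → (∂ w z ≡ᵇ t) ∧ adj u z) ⟩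
    + count (λ z → (∂ w z ≡ᵇ t) ∧ adj u z)
      ≡⟨ cong +_ (neighbour-count w u t) ⟩
    + (up-count ℕ.+ down-count)
      ≡⟨ ℤP.pos-+ up-count down-count ⟩
    + up-count ℤ.+ + down-count
      ≡⟨ cong₂ ℤ._+_ upper (lower t) ⟩
    ((+ c (suc t)) • DistMat ∂ (suc t) ⊕ lowerTerm t) u w
      ∎
    where
    open ≡-Reasoning
    d : ℕ
    d = ∂ w u
    up-count down-count : ℕ
    up-count   = if d ≡ᵇ suc t then c (suc t) else 0
    down-count = if suc d ≡ᵇ t then b d else 0

    as-entry : ∀ t m → + (if d ≡ᵇ t then m else 0) ≡ + m ℤ.* DistMat ∂ t u w
    as-entry t m = trans (guard-as-multiple (d ≡ᵇ t) m)
                         (cong (λ d′ → + m ℤ.* (if d′ ≡ᵇ t then + 1 else + 0)) (∂-sym w u))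
    upper : + up-count ≡ + c (suc t) ℤ.* DistMat ∂ (suc t) u w
    upper = as-entry (suc t) (c (suc t))
    lower : ∀ t → + (if suc d ≡ᵇ t then b d else 0) ≡ lowerTerm t u w
    lower zero    = refl
    lower (suc s) = trans (cong +_ (if-substitute b d s)) (as-entry s (b s))

cprod-suc : ∀ (c : ℕ → ℕ) t → + cprod c (suc t) ≡ + cprod c t ℤ.* + c (suc t)
cprod-suc c t = ℤP.pos-* (cprod c t) (c (suc t))

climb : ∀ (p q a : ℤ) → p ℤ.* (q ℤ.* a ℤ.+ + 0) ≡ p ℤ.* q ℤ.* a
climb = solve-∀

regroup : ∀ (p c₁ c₂ bₘ B a d : ℤ) →
  p ℤ.* c₁ ℤ.* (c₂ ℤ.* a ℤ.+ bₘ ℤ.* d) ℤ.+ B ℤ.* (p ℤ.* d) ≡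
  p ℤ.* c₁ ℤ.* c₂ ℤ.* a ℤ.+ (B ℤ.+ bₘ ℤ.* c₁) ℤ.* (p ℤ.* d)
regroup = solve-∀

x≡[x+y]-y : ∀ (x y : ℤ) → x ≡ (x ℤ.+ y) ℤ.- y
x≡[x+y]-y = solve-∀

module RaisingLowering {n} (adj : Adj n) (∂ : Fin n → Fin n → ℕ) (D : ℕ) (c b : ℕ → ℕ)
                       (simple : IsSimpleGraph adj) (pd : IsPathDistance adj ∂)
                       (bip : IsBipartite adj) (dr : IsDistanceRegular adj ∂ c b)
                       (diam : HasDiameter ∂ D) (x : Fin n) where

  open PathDistance adj ∂ simple pd
  open BipartiteDistance adj ∂ simple pd bip
  open DistanceRegular adj ∂ c b simple pd bip dr
  open DualIdempotents ∂ x public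

  R L : Mat n
  R = Raise adj ∂ x D
  L = Lower adj ∂ x D

  R-term : ∀ u z h → (E (suc h) ⊗ A ⊗ E h) u z ≡
           (if h ≡ᵇ lvl z then (if lvl u ≡ᵇ suc (lvl z) then A u z else + 0) else + 0)
  R-term u z h with h ≟ lvl z
  ... | yes refl = trans (sandwich (suc h) h A u z)
                         (trans (if-cong-then (lvl u ≡ᵇ suc h) (if-yes {m = h} refl))
                                (sym (if-yes {m = h} refl)))
  ... | no h≢lz  = trans (sandwich (suc h) h A u z)
                         (trans (if-zero (lvl u ≡ᵇ suc h) (if-no (h≢lz ∘ sym))) (sym (if-no h≢lz)))

  R-entry : ∀ u z → R u z ≡ (if lvl u ≡ᵇ suc (lvl z) then A u z else + 0)
  R-entry u z with lvl u ≟ suc (lvl z)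
  ... | yes up = trans (sumMat-pick D _ u z (lvl z) (subst (_≤ D) up (proj₁ diam x u))
                                    (λ h → trans (R-term u z h)
                                                 (if-cong-then (h ≡ᵇ lvl z) (if-yes up))))
                       (sym (if-yes up))
  ... | no ¬up = trans (sumMat-zero D _ u z
                         (λ h _ → trans (R-term u z h) (if-zero (h ≡ᵇ lvl z) (if-no ¬up))))
                       (sym (if-no ¬up))

  L-transpose : ∀ u z → L u z ≡ R z u
  L-transpose = sumMat-transpose D _ _ (λ h → sandwich-transpose h (suc h) A A-sym)

  L-entry : ∀ u z → L u z ≡ (if lvl z ≡ᵇ suc (lvl u) then A u z else + 0)
  L-entry u z = trans (L-transpose u z)
                      (trans (R-entry z u) (if-cong-then (lvl z ≡ᵇ suc (lvl u)) (A-sym z u)))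

  R-support : ∀ u z → R u z ≡ + 0 ⊎ lvl u ≡ suc (lvl z)
  R-support u z with lvl u ≟ suc (lvl z)
  ... | yes up = inj₂ up
  ... | no ¬up = inj₁ (trans (R-entry u z) (if-no ¬up))

  L-support : ∀ u z → L u z ≡ + 0 ⊎ lvl z ≡ suc (lvl u)
  L-support u z with lvl z ≟ suc (lvl u)
  ... | yes up = inj₂ up
  ... | no ¬up = inj₁ (trans (L-entry u z) (if-no ¬up))

  -- Every edge joins adjacent levels, so A = R + L.
  R⊕L≈A : R ⊕ L ≈ᴹ A
  R⊕L≈A u z with adjacent-or-zero u z
  ... | inj₂ A≡0 = trans (cong₂ ℤ._+_ (trans (R-entry u z) (if-zero (lvl u ≡ᵇ suc (lvl z)) A≡0))
                                      (trans (L-entry u z) (if-zero (lvl z ≡ᵇ suc (lvl u)) A≡0)))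
                         (sym A≡0)
  ... | inj₁ e with neighbour-distances x u z e
  ...   | inj₁ up   = trans (cong₂ ℤ._+_
                              (trans (R-entry u z) (if-no (not-both-ways up)))
                              (trans (L-entry u z) (if-yes up)))
                            (ℤP.+-identityˡ (A u z))
  ...   | inj₂ down = trans (cong₂ ℤ._+_
                              (trans (R-entry u z) (if-yes down))
                              (trans (L-entry u z) (if-no (not-both-ways down))))
                            (ℤP.+-identityʳ (A u z))

  weightedDist : ℕ → Mat n
  weightedDist t = (+ cprod c t) • DistMat ∂ t

  weightedDist-off : ∀ t u w → ∂ u w ≢ t → weightedDist t u w ≡ + 0
  weightedDist-off t u w ∂≢t =
    trans (cong (+ cprod c t ℤ.*_) (if-no ∂≢t)) (ℤP.*-zeroʳ (+ cprod c t))

  level-gap : ∀ t u w → lvl u ≡ t ℕ.+ lvl w → t ≤ ∂ u w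
  level-gap t u w lvl-u = ℕP.+-cancelʳ-≤ (lvl w) t (∂ u w) (begin
    t ℕ.+ lvl w      ≡⟨ sym lvl-u ⟩
    lvl u            ≤⟨ ∂-triangle x w u ⟩
    lvl w ℕ.+ ∂ w u  ≡⟨ ℕP.+-comm (lvl w) (∂ w u) ⟩
    ∂ w u ℕ.+ lvl w  ≡⟨ cong (ℕ._+ lvl w) (∂-sym w u) ⟩
    ∂ u w ℕ.+ lvl w  ∎)
    where open ℕP.≤-Reasoning

  two-levels-up : ∀ j {v w} → lvl v ≡ suc (suc j) → lvl w ≡ 2 → lvl v ≡ j ℕ.+ lvl w
  two-levels-up j lvl-v lvl-w = trans lvl-v (trans (ℕP.+-comm 2 j) (cong (j ℕ.+_) (sym lvl-w)))

  A-split : ∀ (N : Mat n) u w → (A ⊗ N) u w ≡ (R ⊗ N) u w ℤ.+ (L ⊗ N) u w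
  A-split N u w = trans (sym (⊗-congʳ N R⊕L≈A u w)) (⊗-distribʳ-⊕ R L N u w)

  A-weightedDist : ∀ t u w → (A ⊗ weightedDist t) u w ≡
    + cprod c t ℤ.* (+ c (suc t) ℤ.* DistMat ∂ (suc t) u w ℤ.+ lowerTerm t u w)
  A-weightedDist t u w =
    trans (⊗-• (+ cprod c t) A (DistMat ∂ t) u w) (cong (+ cprod c t ℤ.*_) (three-term t u w))

  -- A step down from a vertex t+1 levels above w leads t+2 levels above w,
  -- too far to reach w in t steps.
  L-overshoots : ∀ t u w → lvl u ≡ suc t ℕ.+ lvl w → (L ⊗ weightedDist t) u w ≡ + 0
  L-overshoots t u w lvl-u = trans (support-cong L (weightedDist t) 𝟎 u w too-far) (⊗-zeroʳ L u w)
    where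
    too-far : ∀ z → L u z ≡ + 0 ⊎ weightedDist t z w ≡ + 0
    too-far z = map₂ (λ up → weightedDist-off t z w (ℕP.>⇒≢ (ℕP.<⇒≤
                        (level-gap (suc (suc t)) z w (trans up (cong suc lvl-u))))))
                     (L-support u z)

  -- Part (i) entrywise: if u lies t levels above w then R^t u w counts the
  -- geodesics from u to w, i.e. R^t u w = c_1 ⋯ c_t [∂(u,w) = t].
  R-power : ∀ t u w → lvl u ≡ t ℕ.+ lvl w → (R ^ᴹ t) u w ≡ weightedDist t u w
  R-power zero    u w _     = trans (𝟏≡A₀ u w) (sym (ℤP.*-identityˡ (DistMat ∂ 0 u w)))
  R-power (suc t) u w lvl-u = begin
    (R ⊗ (R ^ᴹ t)) u w
      ≡⟨ support-cong R (R ^ᴹ t) (weightedDist t) u w from-below ⟩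
    (R ⊗ weightedDist t) u w
      ≡⟨ sym (ℤP.+-identityʳ _) ⟩
    (R ⊗ weightedDist t) u w ℤ.+ + 0
      ≡⟨ cong (λ y → (R ⊗ weightedDist t) u w ℤ.+ y) (sym (L-overshoots t u w lvl-u)) ⟩
    (R ⊗ weightedDist t) u w ℤ.+ (L ⊗ weightedDist t) u w
      ≡⟨ sym (A-split (weightedDist t) u w) ⟩
    (A ⊗ weightedDist t) u w
      ≡⟨ A-weightedDist t u w ⟩
    + cprod c t ℤ.* (+ c (suc t) ℤ.* a ℤ.+ lowerTerm t u w)
      ≡⟨ cong (λ y → + cprod c t ℤ.* (+ c (suc t) ℤ.* a ℤ.+ y))
              (lowerTerm-off t u w (level-gap (suc t) u w lvl-u)) ⟩
    + cprod c t ℤ.* (+ c (suc t) ℤ.* a ℤ.+ + 0)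
      ≡⟨ climb (+ cprod c t) (+ c (suc t)) a ⟩
    + cprod c t ℤ.* + c (suc t) ℤ.* a
      ≡⟨ cong (ℤ._* a) (sym (cprod-suc c t)) ⟩
    weightedDist (suc t) u w
      ∎
    where
    open ≡-Reasoning
    a : ℤ
    a = DistMat ∂ (suc t) u w

    from-below : ∀ z → R u z ≡ + 0 ⊎ (R ^ᴹ t) z w ≡ weightedDist t z w
    from-below z = map₂ (λ up → R-power t z w (ℕP.suc-injective (trans (sym up) lvl-u)))
                        (R-support u z)

  -- Σ_{j=1}^{i-1} b_{j-1} c_j
  correction : ℕ → ℤ
  correction i = + sumℕ (i ∸ 1) (λ j → b j * c (suc j))

  -- For m = 0 both sides vanish because the correction for i = 1 is 0.
  correction-shift : ∀ m (M : Mat n) u w →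
    correction (suc m) ℤ.* (M ^ᴹ suc (m ∸ 1)) u w ≡ correction (suc m) ℤ.* (M ^ᴹ m) u w
  correction-shift zero    M u w = refl
  correction-shift (suc m) M u w = refl

  -- The inductive step of the formula for oneL: the new terms produced by A
  -- are c_{i+1} A_{i+1} and b_{i-1} A_{i-1}, and the latter is absorbed into
  -- the correction term.
  oneL-closing : ∀ i u w → lvl u ≡ suc i → lvl w ≡ 2 →
    + cprod c i ℤ.* (+ c (suc i) ℤ.* DistMat ∂ (suc i) u w ℤ.+ lowerTerm i u w)
      ℤ.+ correction i ℤ.* (R ^ᴹ suc (i ∸ 2)) u w
    ≡ weightedDist (suc i) u w ℤ.+ correction (suc i) ℤ.* (R ^ᴹ (suc i ∸ 2)) u w
  oneL-closing zero u w _ _ =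
    cong₂ ℤ._+_ (trans (climb (+ 1) (+ c 1) (DistMat ∂ 1 u w))
                       (cong (ℤ._* DistMat ∂ 1 u w) (sym (cprod-suc c 0))))
                refl
  oneL-closing (suc m) u w lvl-u lvl-w = begin
    + cprod c (suc m) ℤ.* (c₂ ℤ.* a ℤ.+ bₘ ℤ.* d) ℤ.+ B ℤ.* (R ^ᴹ suc (m ∸ 1)) u w
      ≡⟨ cong₂ (λ q r → q ℤ.* (c₂ ℤ.* a ℤ.+ bₘ ℤ.* d) ℤ.+ r)
               (cprod-suc c m)
               (trans (correction-shift m R u w) (cong (B ℤ.*_) Rᵐ)) ⟩
    p ℤ.* c₁ ℤ.* (c₂ ℤ.* a ℤ.+ bₘ ℤ.* d) ℤ.+ B ℤ.* (p ℤ.* d)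
      ≡⟨ regroup p c₁ c₂ bₘ B a d ⟩
    p ℤ.* c₁ ℤ.* c₂ ℤ.* a ℤ.+ (B ℤ.+ bₘ ℤ.* c₁) ℤ.* (p ℤ.* d)
      ≡⟨ cong₂ (λ q r → q ℤ.* a ℤ.+ r ℤ.* (p ℤ.* d)) (sym cprod₂) (sym correction-step) ⟩
    + cprod c (suc (suc m)) ℤ.* a ℤ.+ correction (suc (suc m)) ℤ.* (p ℤ.* d)
      ≡⟨ cong (λ r → + cprod c (suc (suc m)) ℤ.* a ℤ.+ correction (suc (suc m)) ℤ.* r)
              (sym Rᵐ) ⟩
    weightedDist (suc (suc m)) u w ℤ.+ correction (suc (suc m)) ℤ.* (R ^ᴹ m) u w
      ∎
    where
    open ≡-Reasoning
    p c₁ c₂ bₘ B a d : ℤ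
    p  = + cprod c m
    c₁ = + c (suc m)
    c₂ = + c (suc (suc m))
    bₘ = + b m
    B  = correction (suc m)
    a  = DistMat ∂ (suc (suc m)) u w
    d  = DistMat ∂ m u w

    Rᵐ : (R ^ᴹ m) u w ≡ p ℤ.* d
    Rᵐ = R-power m u w (two-levels-up m lvl-u lvl-w)

    cprod₂ : + cprod c (suc (suc m)) ≡ p ℤ.* c₁ ℤ.* c₂
    cprod₂ = trans (cprod-suc c (suc m)) (cong (ℤ._* c₂) (cprod-suc c m))

    correction-step : correction (suc (suc m)) ≡ B ℤ.+ bₘ ℤ.* c₁
    correction-step = trans (ℤP.pos-+ (sumℕ m (λ j → b j * c (suc j))) (b m * c (suc m)))
                            (cong (λ y → B ℤ.+ y) (ℤP.pos-* (b m) (c (suc m))))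

  oneL-formula : ∀ i u w → lvl u ≡ i → lvl w ≡ 2 →
    oneL R L i u w ≡ weightedDist i u w ℤ.+ correction i ℤ.* (R ^ᴹ (i ∸ 2)) u w
  oneL-formula zero u w lvl-u lvl-w =
    sym (trans (ℤP.+-identityʳ _) (trans (ℤP.*-identityˡ _) (if-no distinct)))
    where
    distinct : ∂ u w ≢ 0
    distinct ∂≡0 with trans (sym lvl-u) (trans (cong lvl (∂≡0⇒≡ u w ∂≡0)) lvl-w)
    ... | ()
  oneL-formula (suc i) u w lvl-u lvl-w = begin
    oneL R L (suc i) u w
      ≡⟨ oneL-step R L i u w ⟩
    (R ⊗ oneL R L i) u w ℤ.+ (L ⊗ (R ^ᴹ i)) u w
      ≡⟨ cong₂ ℤ._+_ (support-cong R (oneL R L i) Nᵢ u w from-below)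
                     (support-cong L (R ^ᴹ i) (weightedDist i) u w from-above) ⟩
    (R ⊗ Nᵢ) u w ℤ.+ (L ⊗ weightedDist i) u w
      ≡⟨ cong (ℤ._+ (L ⊗ weightedDist i) u w)
              (trans (⊗-distribˡ-⊕ R (weightedDist i) (correction i • (R ^ᴹ (i ∸ 2))) u w)
                     (cong (λ y → (R ⊗ weightedDist i) u w ℤ.+ y)
                           (⊗-• (correction i) R (R ^ᴹ (i ∸ 2)) u w))) ⟩
    (R ⊗ weightedDist i) u w ℤ.+ β ℤ.+ (L ⊗ weightedDist i) u w
      ≡⟨ CS.xy∙z≈xz∙y ℤP.+-commutativeSemigroup
                      ((R ⊗ weightedDist i) u w) β ((L ⊗ weightedDist i) u w) ⟩
    (R ⊗ weightedDist i) u w ℤ.+ (L ⊗ weightedDist i) u w ℤ.+ β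
      ≡⟨ cong (ℤ._+ β) (trans (sym (A-split (weightedDist i) u w)) (A-weightedDist i u w)) ⟩
    + cprod c i ℤ.* (+ c (suc i) ℤ.* DistMat ∂ (suc i) u w ℤ.+ lowerTerm i u w) ℤ.+ β
      ≡⟨ oneL-closing i u w lvl-u lvl-w ⟩
    weightedDist (suc i) u w ℤ.+ correction (suc i) ℤ.* (R ^ᴹ (suc i ∸ 2)) u w
      ∎
    where
    open ≡-Reasoning
    Nᵢ : Mat n
    Nᵢ = weightedDist i ⊕ correction i • (R ^ᴹ (i ∸ 2))
    β : ℤ
    β = correction i ℤ.* (R ^ᴹ suc (i ∸ 2)) u w

    from-below : ∀ z → R u z ≡ + 0 ⊎ oneL R L i z w ≡ Nᵢ z w
    from-below z = map₂ (λ down → oneL-formula i z w (ℕP.suc-injective (trans (sym down) lvl-u)) lvl-w)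
                        (R-support u z)

    from-above : ∀ z → L u z ≡ + 0 ⊎ (R ^ᴹ i) z w ≡ weightedDist i z w
    from-above z = map₂ (λ up → R-power i z w (two-levels-up i (trans up (cong suc lvl-u)) lvl-w))
                        (L-support u z)

lemma4p5 : (n : ℕ) (adj : Adj n) (∂ : Fin n → Fin n → ℕ) (D k : ℕ) (c b : ℕ → ℕ) →
    IsSimpleGraph adj → IsPathDistance adj ∂ → IsBipartite adj →
    IsDistanceRegular adj ∂ c b → HasDiameter ∂ D → IsRegular adj k →
    4 ≤ D → 3 ≤ k → (x : Fin n) →
    let E = Estar ∂ x
        L = Lower adj ∂ x D
        R = Raise adj ∂ x D
    in (i : ℕ) → 2 ≤ i → i ≤ D →
       ((+ cprod c (i ∸ 2)) • (E i ⊗ DistMat ∂ (i ∸ 2) ⊗ E 2)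
          ≈ᴹ E i ⊗ (R ^ᴹ (i ∸ 2)) ⊗ E 2)
       ×
       ((+ cprod c i) • (E i ⊗ DistMat ∂ i ⊗ E 2)
          ≈ᴹ E i ⊗ (sumMat i (λ j → (R ^ᴹ (i ∸ 1 ∸ j)) ⊗ L ⊗ (R ^ᴹ j))
                    ⊖ (+ sumℕ (i ∸ 1) (λ j → b j * c (suc j))) • (R ^ᴹ (i ∸ 2)))
                 ⊗ E 2)
lemma4p5 n adj ∂ D k c b simple pd bip dr diam _ _ _ x i 2≤i _ = part-i , part-ii
  where
  open RaisingLowering adj ∂ D c b simple pd bip dr diam x

  part-i : (+ cprod c (i ∸ 2)) • (E i ⊗ DistMat ∂ (i ∸ 2) ⊗ E 2) ≈ᴹ
           E i ⊗ (R ^ᴹ (i ∸ 2)) ⊗ E 2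
  part-i = ≈-trans (•-sandwich (+ cprod c (i ∸ 2)) (E i) (DistMat ∂ (i ∸ 2)) (E 2))
    (sandwich-cong i 2 (λ u w lvl-u lvl-w → sym (R-power (i ∸ 2) u w
      (trans lvl-u (trans (sym (ℕP.m∸n+n≡m 2≤i)) (cong ((i ∸ 2) ℕ.+_) (sym lvl-w)))))))

  part-ii : (+ cprod c i) • (E i ⊗ DistMat ∂ i ⊗ E 2) ≈ᴹ
            E i ⊗ (oneL R L i ⊖ correction i • (R ^ᴹ (i ∸ 2))) ⊗ E 2
  part-ii = ≈-trans (•-sandwich (+ cprod c i) (E i) (DistMat ∂ i) (E 2))
    (sandwich-cong i 2 (λ u w lvl-u lvl-w →
      trans (x≡[x+y]-y (weightedDist i u w) (correction i ℤ.* (R ^ᴹ (i ∸ 2)) u w))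
            (cong (ℤ._- correction i ℤ.* (R ^ᴹ (i ∸ 2)) u w) (sym (oneL-formula i u w lvl-u lvl-w)))))
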